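{- There exists $\varepsilon_0>0$ such that for every $\varepsilon\in(0,\varepsilon_0)$, setting $c=4.383-\varepsilon$, the following holds. Let $n\ge1$ and let $P$ be the path with vertices $v_0,v_1,\dots,v_n$ and edges $v_iv_{i+1}$ ($0\le i<n$), and let $B=\{v_0,v_n\}$. Fix $j\in\mathbb{Z}$ and let $S(n)$ be the number of prototypes $(A,f)$ (of $P$ with respect to $B$) satisfying $v_0\in A$ and $f(v_0)=j$. Then $S(n)\le 5.02\cdot c^{n-1}$, and at least $0.4\,S(n)$ of these prototypes satisfy $v_n\notin A$.
   Context: Let $G=(V,E)$ be a graph. For $A\subseteq V$ and $f:A\to\mathbb{Z}$, a bucket extension of $f$ is $\bar f:V\to\mathbb{Z}$ with: (1) $\bar f|_A=f$; (2) $|\bar f(u)-\bar f(v)|\le1$ for every edge $uv$; (3) $\bar f(u)\ge\bar f(v)$ for every edge $uv$ with $u\in A$, $v\notin A$. $(A,f)$ is a partial bucket function if $f$ has a bucket extension. For a fixed $B\subseteq V$, a prototype is a pair $(A,f)$ with $A\subseteq V$ and $f:A\cup B\to\mathbb{Z}$ such that $(A,f|_A)$ is a partial bucket function and there exists a bucket extension $\bar f$ of $f|_A$ with $\bar f|_{A\cup B}=f$.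
   Formalization: The parameter ε ranges over the rationals in $(0,\varepsilon_0)$, and the threshold ε₀ is taken in ℚ. -}

module Defs where

open import Data.Nat as ℕ using (ℕ; zero; suc)
open import Data.Integer as ℤ using (ℤ; ∣_∣)
open import Data.Bool using (Bool; true; false; T; if_then_else_)
open import Data.Maybe using (Maybe; just; nothing)
import Data.Fin
open import Data.Fin using (Fin; toℕ; fromℕ)
open import Data.Vec using (Vec; lookup)
open import Data.List using (List; length)
open import Data.List.Membership.Propositional using (_∈_)
open import Data.List.Relation.Unary.Unique.Propositional using (Unique)
open import Data.Product using (Σ; _×_; _,_; ∃; ∃-syntax)
open import Data.Sum using (_⊎_)
open import Data.Rational as ℚ using (ℚ; 1ℚ)
open import Relation.Nullary using (¬_)
open import Relation.Binary.PropositionalEquality using (_≡_)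

-- A graph is a vertex type V with an edge
-- relation E (for an undirected graph, E u v and E v u both hold for
-- each edge uv, so conditions "for every edge uv" range over both
-- orientations).

module _ {V : Set} (E : V → V → Set) where

  IsBucketExt : (A : V → Bool) → (h : V → Maybe ℤ) → (fbar : V → ℤ) → Set
  IsBucketExt A h fbar =
      (∀ v → T (A v) → h v ≡ just (fbar v))
    × (∀ u v → E u v → ∣ fbar u ℤ.- fbar v ∣ ℕ.≤ 1)
    × (∀ u v → E u v → T (A u) → ¬ T (A v) → fbar v ℤ.≤ fbar u)

  HasDomain : (D : V → Set) → (h : V → Maybe ℤ) → Set
  HasDomain D h = ∀ v → (D v → ∃[ z ] h v ≡ just z) × (∀ z → h v ≡ just z → D v)

  IsPartialBucket : (A : V → Bool) → (h : V → Maybe ℤ) → Set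
  IsPartialBucket A h = HasDomain (λ v → T (A v)) h × ∃[ fbar ] IsBucketExt A h fbar

  restrict : (A : V → Bool) → (V → Maybe ℤ) → V → Maybe ℤ
  restrict A f v = if A v then f v else nothing

  IsPrototype : (B : V → Set) → (A : V → Bool) → (f : V → Maybe ℤ) → Set
  IsPrototype B A f =
      HasDomain (λ v → T (A v) ⊎ B v) f
    × IsPartialBucket A (restrict A f)
    × ∃[ fbar ] (IsBucketExt A (restrict A f) fbar
                 × (∀ v → T (A v) ⊎ B v → f v ≡ just (fbar v)))

-- Counting: "the number of x : X with P x is k", for X with propositional
-- equality as identity: a duplicate-free list whose members are exactly
-- the x satisfying P.

HasCount : {X : Set} → (X → Set) → ℕ → Set
HasCount {X} P k = Σ (List X) λ L →
  Unique L × length L ≡ k × (∀ x → (P x → x ∈ L) × (x ∈ L → P x))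

PathEdge : (n : ℕ) → Fin (suc n) → Fin (suc n) → Set
PathEdge n u v = toℕ v ≡ suc (toℕ u) ⊎ toℕ u ≡ suc (toℕ v)

PathB : (n : ℕ) → Fin (suc n) → Set
PathB n v = toℕ v ≡ 0 ⊎ toℕ v ≡ n

ProtoData : ℕ → Set
ProtoData n = Vec Bool (suc n) × Vec (Maybe ℤ) (suc n)

CountedProto : (n : ℕ) → ℤ → ProtoData n → Set
CountedProto n j (A , f) =
    IsPrototype (PathEdge n) (PathB n) (lookup A) (lookup f)
  × lookup A Data.Fin.zero ≡ true
  × lookup f Data.Fin.zero ≡ just j

CountedProtoNotLast : (n : ℕ) → ℤ → ProtoData n → Set
CountedProtoNotLast n j (A , f) =
  CountedProto n j (A , f) × lookup A (fromℕ n) ≡ false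

_^ℚ_ : ℚ → ℕ → ℚ
q ^ℚ zero = 1ℚ
q ^ℚ suc k = q ℚ.* (q ^ℚ k)

module Submission where

-- On the path v₀ … v_n, a prototype (A, f) with v₀ ∈ A and f(v₀) = j amounts
-- to the sequence of membership bits and recorded values together with some
-- bucket extension, and all constraints on it are local to the edges
-- (Witness, Chain).  Reading the path from v₀ we list these sequences
-- explicitly (fromA, fromOut): a vertex of A fixes the extension value, while
-- along a run of vertices outside A only the range [lo, lo+k] of feasible
-- values matters; four "window" lemmas describe how values and ranges move
-- along one edge.  Soundness, completeness and absence of repetitions of the
-- lists give exact counts countA true n, and countA false n when v_n ∉ A is
-- required.  The counts obey a linear recurrence (Profile); two invariants of
-- it give countA true (m+3) ≤ (17/4)·countA true (m+2) and
-- 2·countA true (m+1) ≤ 5·countA false (m+1).  With ε₀ = 1/2000 and the first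
-- counts 5 and 22, a geometric bound (geometric-bound) yields the theorem.

open import Defs
open import Data.Nat as ℕ using (ℕ; zero; suc; _∸_; z≤n; s≤s)
import Data.Nat.Properties as ℕP
open import Data.Integer as ℤ using (ℤ; +_; -[1+_]; _+_; -_; 1ℤ; -1ℤ; 0ℤ; ∣_∣; +≤+; -≤+)
import Data.Integer.Properties as ℤP
open import Data.Integer.Tactic.RingSolver using (solve-∀)
open import Data.Nat.Tactic.RingSolver using () renaming (solve-∀ to ℕ-solve-∀)
open import Data.Bool using (Bool; true; false; T; if_then_else_)
open import Data.Unit using (tt)
open import Data.Empty using (⊥; ⊥-elim)
open import Data.Maybe using (Maybe; just; nothing; fromMaybe)
open import Data.Maybe.Properties using (just-injective)
open import Data.Fin using (Fin; toℕ; fromℕ) renaming (zero to fzero; suc to fsuc)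
open import Data.Vec using (Vec; []; _∷_; lookup; tabulate)
open import Data.List using (List; []; _∷_; _++_; map; length)
open import Data.List.Properties using (length-++; length-map)
open import Data.List.Membership.Propositional using (_∈_)
open import Data.List.Membership.Propositional.Properties using (∈-++⁻; ∈-++⁺ˡ; ∈-++⁺ʳ; ∈-map⁺; ∈-map⁻)
open import Data.List.Relation.Unary.Any using (here)
open import Data.List.Relation.Unary.Unique.Propositional using (Unique)
import Data.List.Relation.Unary.AllPairs.Core as AllPairs
import Data.List.Relation.Unary.All as All
import Data.List.Relation.Unary.Unique.Propositional.Properties as UniqueP
open import Data.Product using (∃-syntax; _×_; _,_; proj₁; proj₂)
open import Data.Product.Properties using (,-injectiveʳ)
open import Data.Sum using (_⊎_; inj₁; inj₂)
open import Data.Rational using (ℚ; mkℚ; 0ℚ; 1ℚ; _/_; _-_; _*_; _<_; _≤_; ↥_; ↧_; nonNegative)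
import Data.Rational.Properties as ℚP
import Data.Rational.Unnormalised as ℚᵘ
import Data.Rational.Unnormalised.Properties as ℚᵘP
import Data.Nat.Coprimality as Coprime
open import Relation.Binary.PropositionalEquality
open import Function using (_∘_)
open import Relation.Nullary using (¬_; yes; no)
open import Relation.Nullary.Decidable using (toWitness)

Near : ℤ → ℤ → Set
Near x y = x ℤ.≤ ℤ.suc y × y ℤ.≤ ℤ.suc x

near-refl : ∀ x → Near x x
near-refl x = ℤP.i≤suc[i] x , ℤP.i≤suc[i] x

near-sym : ∀ {x y} → Near x y → Near y x
near-sym (p , q) = q , p

abs≤1⇒≤1 : ∀ d → ∣ d ∣ ℕ.≤ 1 → d ℤ.≤ 1ℤ
abs≤1⇒≤1 (+ 0) _ = +≤+ z≤n
abs≤1⇒≤1 (+ 1) _ = ℤP.≤-refl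
abs≤1⇒≤1 (+ suc (suc _)) (s≤s ())
abs≤1⇒≤1 -[1+ _ ] _ = -≤+

≤1⇒abs≤1 : ∀ d → d ℤ.≤ 1ℤ → - d ℤ.≤ 1ℤ → ∣ d ∣ ℕ.≤ 1
≤1⇒abs≤1 (+ 0) _ _ = z≤n
≤1⇒abs≤1 (+ 1) _ _ = s≤s z≤n
≤1⇒abs≤1 (+ suc (suc _)) (+≤+ (s≤s ())) _
≤1⇒abs≤1 -[1+ 0 ] _ _ = s≤s z≤n
≤1⇒abs≤1 -[1+ suc _ ] _ (+≤+ (s≤s ()))

diff≤1⇒≤suc : ∀ x y → x ℤ.- y ℤ.≤ 1ℤ → x ℤ.≤ ℤ.suc y
diff≤1⇒≤suc x y h = subst (ℤ._≤ 1ℤ + y) (minus-plus x y) (ℤP.+-monoˡ-≤ y h)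
  where
  minus-plus : ∀ x y → (x ℤ.- y) + y ≡ x
  minus-plus = solve-∀

≤suc⇒diff≤1 : ∀ x y → x ℤ.≤ ℤ.suc y → x ℤ.- y ℤ.≤ 1ℤ
≤suc⇒diff≤1 x y h = subst (x ℤ.- y ℤ.≤_) (plus-minus y) (ℤP.+-monoˡ-≤ (- y) h)
  where
  plus-minus : ∀ y → (1ℤ + y) ℤ.- y ≡ 1ℤ
  plus-minus = solve-∀

near⇒abs≤1 : ∀ x y → Near x y → ∣ x ℤ.- y ∣ ℕ.≤ 1
near⇒abs≤1 x y (p , q) =
  ≤1⇒abs≤1 (x ℤ.- y) (≤suc⇒diff≤1 x y p) (subst (ℤ._≤ 1ℤ) (swap-minus y x) (≤suc⇒diff≤1 y x q))
  where
  swap-minus : ∀ y x → y ℤ.- x ≡ - (x ℤ.- y)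
  swap-minus = solve-∀

abs≤1⇒near : ∀ x y → ∣ x ℤ.- y ∣ ℕ.≤ 1 → Near x y
abs≤1⇒near x y h =
  diff≤1⇒≤suc x y (abs≤1⇒≤1 (x ℤ.- y) h) ,
  diff≤1⇒≤suc y x (abs≤1⇒≤1 (y ℤ.- x) (subst (ℕ._≤ 1) (ℤP.∣i-j∣≡∣j-i∣ x y) h))

InRange : ℤ → ℕ → ℤ → Set
InRange lo k x = lo ℤ.≤ x × x ℤ.≤ lo + + k

lo+suc : ∀ lo k → lo + + suc k ≡ ℤ.suc (lo + + k)
lo+suc lo k = trans (cong (λ t → lo + t) (ℤP.pos-+ 1 k)) (shuffle lo (+ k))
  where
  shuffle : ∀ a b → a + (1ℤ + b) ≡ 1ℤ + (a + b)
  shuffle = solve-∀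

pred+2+k : ∀ lo k → ℤ.pred lo + + suc (suc k) ≡ ℤ.suc (lo + + k)
pred+2+k lo k = trans (cong (λ t → ℤ.pred lo + t) (ℤP.pos-+ 2 k)) (shuffle lo (+ k))
  where
  shuffle : ∀ a b → (-1ℤ + a) + (+ 2 + b) ≡ 1ℤ + (a + b)
  shuffle = solve-∀

pred+1 : ∀ a → ℤ.pred a + + 1 ≡ a
pred+1 = identity
  where
  identity : ∀ a → (-1ℤ + a) + + 1 ≡ a
  identity = solve-∀

pred+2 : ∀ a → ℤ.pred a + + 2 ≡ ℤ.suc a
pred+2 = identity
  where
  identity : ∀ a → (-1ℤ + a) + + 2 ≡ 1ℤ + a
  identity = solve-∀

pred≤⇒≤suc : ∀ {a b} → ℤ.pred a ℤ.≤ b → a ℤ.≤ ℤ.suc b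
pred≤⇒≤suc {a} p = subst (ℤ._≤ _) (ℤP.suc-pred a) (ℤP.suc-mono p)

≤suc⇒pred≤ : ∀ {a b} → a ℤ.≤ ℤ.suc b → ℤ.pred a ℤ.≤ b
≤suc⇒pred≤ {b = b} p = subst (_ ℤ.≤_) (ℤP.pred-suc b) (ℤP.pred-mono p)

rangeConcat : {X : Set} → (ℤ → List X) → ℤ → ℕ → List X
rangeConcat g lo zero = g lo
rangeConcat g lo (suc k) = g lo ++ rangeConcat g (ℤ.suc lo) k

suc-lo+k : ∀ lo k → ℤ.suc lo + + k ≡ lo + + suc k
suc-lo+k lo k = trans (ℤP.+-assoc 1ℤ lo (+ k)) (sym (lo+suc lo k))

∈-rangeConcat⁻ : {X : Set} (g : ℤ → List X) → ∀ lo k {x} →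
  x ∈ rangeConcat g lo k → ∃[ b ] (InRange lo k b × x ∈ g b)
∈-rangeConcat⁻ g lo zero x∈ = lo , (ℤP.≤-refl , ℤP.i≤i+j lo (+ 0)) , x∈
∈-rangeConcat⁻ g lo (suc k) x∈ with ∈-++⁻ (g lo) x∈
... | inj₁ x∈g = lo , (ℤP.≤-refl , ℤP.i≤i+j lo (+ suc k)) , x∈g
... | inj₂ x∈rest with ∈-rangeConcat⁻ g (ℤ.suc lo) k x∈rest
... | b , (p , q) , x∈g =
  b , (ℤP.≤-trans (ℤP.i≤suc[i] lo) p , subst (b ℤ.≤_) (suc-lo+k lo k) q) , x∈g

∈-rangeConcat⁺ : {X : Set} (g : ℤ → List X) → ∀ lo k {x} b →
  InRange lo k b → x ∈ g b → x ∈ rangeConcat g lo k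
∈-rangeConcat⁺ g lo zero b (p , q) x∈
  rewrite ℤP.≤-antisym (subst (b ℤ.≤_) (ℤP.+-identityʳ lo) q) p = x∈
∈-rangeConcat⁺ g lo (suc k) b (p , q) x∈ with b ℤ.≟ lo
... | yes refl = ∈-++⁺ˡ x∈
... | no b≢lo = ∈-++⁺ʳ (g lo) (∈-rangeConcat⁺ g (ℤ.suc lo) k b
  (ℤP.i<j⇒suc[i]≤j (ℤP.≤∧≢⇒< p (λ lo≡b → b≢lo (sym lo≡b))) , subst (b ℤ.≤_) (sym (suc-lo+k lo k)) q)
  x∈)

length-rangeConcat : {X : Set} (g : ℤ → List X) (c : ℕ) → (∀ b → length (g b) ≡ c) →
  ∀ lo k → length (rangeConcat g lo k) ≡ suc k ℕ.* c
length-rangeConcat g c len lo zero = trans (len lo) (sym (ℕP.+-identityʳ c))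
length-rangeConcat g c len lo (suc k) =
  trans (length-++ (g lo)) (cong₂ ℕ._+_ (len lo) (length-rangeConcat g c len (ℤ.suc lo) k))

singleton-unique : {X : Set} (x : X) → Unique (x ∷ [])
singleton-unique x = All.[] AllPairs.∷ AllPairs.[]

-- If every element of g b carries the label b, the blocks are disjoint.
unique-rangeConcat : {X : Set} (g : ℤ → List X) (label : X → ℤ) → (∀ b → Unique (g b)) →
  (∀ b {x} → x ∈ g b → label x ≡ b) → ∀ lo k → Unique (rangeConcat g lo k)
unique-rangeConcat g label uniq labelled lo zero = uniq lo
unique-rangeConcat g label uniq labelled lo (suc k) =
  UniqueP.++⁺ (uniq lo) (unique-rangeConcat g label uniq labelled (ℤ.suc lo) k) disjoint
  where
  disjoint : ∀ {x} → ¬ (x ∈ g lo × x ∈ rangeConcat g (ℤ.suc lo) k)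
  disjoint (x∈lo , x∈rest) with ∈-rangeConcat⁻ g (ℤ.suc lo) k x∈rest
  ... | b , (suc-lo≤b , _) , x∈b =
    ℤP.<-irrefl (trans (sym (labelled lo x∈lo)) (labelled b x∈b)) (ℤP.suc[i]≤j⇒i<j suc-lo≤b)

Compatible : Bool → ℤ → Bool → ℤ → Set
Compatible true  x true  y = Near x y
Compatible true  x false y = Near x y × y ℤ.≤ x
Compatible false x true  y = Near x y × x ℤ.≤ y
Compatible false x false y = Near x y

-- Compatible is the conjunction of the edge conditions (2) and (3) of a
-- bucket extension, in both orientations of the edge.
compatible : ∀ a x a' y → Near x y → (T a → ¬ T a' → y ℤ.≤ x) → (T a' → ¬ T a → x ℤ.≤ y) →
  Compatible a x a' y
compatible true  x true  y n _ _ = n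
compatible true  x false y n down _ = n , down tt (λ ())
compatible false x true  y n _ up = n , up tt (λ ())
compatible false x false y n _ _ = n

compatible⇒near : ∀ a x a' y → Compatible a x a' y → Near x y
compatible⇒near true  x true  y n = n
compatible⇒near true  x false y (n , _) = n
compatible⇒near false x true  y (n , _) = n
compatible⇒near false x false y n = n

compatible⇒down : ∀ a x a' y → Compatible a x a' y → T a → ¬ T a' → y ℤ.≤ x
compatible⇒down true  x true  y _ _ ∉A = ⊥-elim (∉A tt)
compatible⇒down true  x false y (_ , y≤x) _ _ = y≤x

compatible⇒up : ∀ a x a' y → Compatible a x a' y → T a' → ¬ T a → x ℤ.≤ y
compatible⇒up true  x true  y _ _ ∉A = ⊥-elim (∉A tt)
compatible⇒up false x true  y (_ , x≤y) _ _ = x≤y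

-- The value f records at a vertex with extension value x: defined iff the
-- vertex is in A (the last vertex, which is in B, is handled by Chain).
Recorded : Bool → ℤ → Maybe ℤ → Set
Recorded true  x y = y ≡ just x
Recorded false x y = y ≡ nothing

Chain : ∀ {m} → Bool → ℤ → Maybe ℤ → Vec Bool m → Vec (Maybe ℤ) m → Vec ℤ m → Set
Chain a x y [] [] [] = y ≡ just x
Chain a x y (a' ∷ as) (y' ∷ fs) (x' ∷ xs) = Recorded a x y × Compatible a x a' x' × Chain a' x' y' as fs xs

record Witness (m : ℕ) (A : Vec Bool (suc m)) (f : Vec (Maybe ℤ) (suc m)) (g : Fin (suc m) → ℤ) : Set where
  field
    recorded   : ∀ v → T (lookup A v) ⊎ toℕ v ≡ m → lookup f v ≡ just (g v)
    unrecorded : ∀ v → ¬ T (lookup A v) → toℕ v ≢ m → lookup f v ≡ nothing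
    near       : ∀ u v → PathEdge m u v → Near (g u) (g v)
    monotone   : ∀ u v → PathEdge m u v → T (lookup A u) → ¬ T (lookup A v) → g v ℤ.≤ g u

pathEdge-elim : ∀ {m} (P : Fin (suc (suc m)) → Fin (suc (suc m)) → Set) →
  P fzero (fsuc fzero) → P (fsuc fzero) fzero → (∀ u v → PathEdge m u v → P (fsuc u) (fsuc v)) →
  ∀ u v → PathEdge (suc m) u v → P u v
pathEdge-elim P first _ _ fzero (fsuc fzero) _ = first
pathEdge-elim P _ first⁻¹ _ (fsuc fzero) fzero _ = first⁻¹
pathEdge-elim P _ _ rest (fsuc u) (fsuc v) (inj₁ e) = rest u v (inj₁ (ℕP.suc-injective e))
pathEdge-elim P _ _ rest (fsuc u) (fsuc v) (inj₂ e) = rest u v (inj₂ (ℕP.suc-injective e))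
pathEdge-elim P _ _ _ fzero fzero (inj₁ ())
pathEdge-elim P _ _ _ fzero fzero (inj₂ ())
pathEdge-elim P _ _ _ fzero (fsuc (fsuc _)) (inj₁ ())
pathEdge-elim P _ _ _ fzero (fsuc _) (inj₂ ())
pathEdge-elim P _ _ _ (fsuc _) fzero (inj₁ ())
pathEdge-elim P _ _ _ (fsuc (fsuc _)) fzero (inj₂ ())

subpathEdge : ∀ {m} {u v : Fin (suc m)} → PathEdge m u v → PathEdge (suc m) (fsuc u) (fsuc v)
subpathEdge (inj₁ e) = inj₁ (cong suc e)
subpathEdge (inj₂ e) = inj₂ (cong suc e)

witness-tail : ∀ {m a A y f g} → Witness (suc m) (a ∷ A) (y ∷ f) g → Witness m A f (g ∘ fsuc)
witness-tail {m} W = record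
  { recorded   = λ { v (inj₁ v∈A) → recorded (fsuc v) (inj₁ v∈A)
                   ; v (inj₂ last) → recorded (fsuc v) (inj₂ (cong suc last)) }
  ; unrecorded = λ v v∉A notLast → unrecorded (fsuc v) v∉A (notLast ∘ ℕP.suc-injective)
  ; near       = λ u v e → near (fsuc u) (fsuc v) (subpathEdge e)
  ; monotone   = λ u v e → monotone (fsuc u) (fsuc v) (subpathEdge e)
  }
  where open Witness W

witness-cons : ∀ {m a a' A y y' f x xs} → Witness m (a' ∷ A) (y' ∷ f) (lookup xs) →
  Recorded a x y → Compatible a x a' (lookup xs fzero) →
  Witness (suc m) (a ∷ a' ∷ A) (y ∷ y' ∷ f) (lookup (x ∷ xs))
witness-cons {m} {a} {a'} {A} {y} {x = x} {xs} W rec compat = record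
  { recorded   = λ { fzero (inj₁ a∈A) → recordedHead a rec a∈A
                   ; fzero (inj₂ ())
                   ; (fsuc v) (inj₁ v∈A) → recorded v (inj₁ v∈A)
                   ; (fsuc v) (inj₂ last) → recorded v (inj₂ (ℕP.suc-injective last)) }
  ; unrecorded = λ { fzero a∉A _ → unrecordedHead a rec a∉A
                   ; (fsuc v) v∉A notLast → unrecorded v v∉A (notLast ∘ cong suc) }
  ; near       = pathEdge-elim _ (compatible⇒near a x a' x₁ compat)
                   (near-sym (compatible⇒near a x a' x₁ compat)) near
  ; monotone   = pathEdge-elim _ (compatible⇒down a x a' x₁ compat)
                   (compatible⇒up a x a' x₁ compat) monotone
  }
  where
  open Witness W
  x₁ : ℤ
  x₁ = lookup xs fzero
  recordedHead : ∀ b → Recorded b x y → T b → y ≡ just x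
  recordedHead true rec _ = rec
  unrecordedHead : ∀ b → Recorded b x y → ¬ T b → y ≡ nothing
  unrecordedHead true _ b∉A = ⊥-elim (b∉A tt)
  unrecordedHead false rec _ = rec

witness-head : ∀ {m a A y f g} → Witness (suc m) (a ∷ A) (y ∷ f) g → Recorded a (g fzero) y
witness-head {a = true}  W = Witness.recorded W fzero (inj₁ tt)
witness-head {a = false} W = Witness.unrecorded W fzero (λ ()) (λ ())

witness⇒chain : ∀ {m a as y fs g} → Witness m (a ∷ as) (y ∷ fs) g →
  Chain a (g fzero) y as fs (tabulate (g ∘ fsuc))
witness⇒chain {zero} {as = []} {fs = []} W = Witness.recorded W fzero (inj₂ refl)
witness⇒chain {suc m} {a} {a' ∷ as} {y} {y' ∷ fs} {g} W =
  witness-head W ,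
  compatible a (g fzero) a' (g (fsuc fzero)) (near fzero (fsuc fzero) (inj₁ refl))
    (monotone fzero (fsuc fzero) (inj₁ refl)) (monotone (fsuc fzero) fzero (inj₂ refl)) ,
  witness⇒chain (witness-tail W)
  where open Witness W

chain⇒witness : ∀ {m a as y fs x xs} → Chain a x y as fs xs → Witness m (a ∷ as) (y ∷ fs) (lookup (x ∷ xs))
chain⇒witness {as = []} {fs = []} {xs = []} y≡x = record
  { recorded   = λ { fzero _ → y≡x }
  ; unrecorded = λ { fzero _ notLast → ⊥-elim (notLast refl) }
  ; near       = λ { fzero fzero (inj₁ ()) ; fzero fzero (inj₂ ()) }
  ; monotone   = λ { fzero fzero (inj₁ ()) ; fzero fzero (inj₂ ()) }
  }
chain⇒witness {as = _ ∷ _} {fs = _ ∷ _} {xs = _ ∷ _} (rec , compat , rest) =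
  witness-cons (chain⇒witness rest) rec compat

restrict-on : ∀ (b : Bool) (y : Maybe ℤ) → T b → (if b then y else nothing) ≡ y
restrict-on true y _ = refl

restrict-defined : ∀ (b : Bool) (y : Maybe ℤ) {z} → (if b then y else nothing) ≡ just z → T b
restrict-defined true y _ = tt

index0 : ∀ {n} {v : Fin (suc n)} → toℕ v ≡ 0 → v ≡ fzero
index0 {v = fzero} _ = refl

module _ {n : ℕ} {as : Vec Bool n} {f : Vec (Maybe ℤ) (suc n)} where

  private
    A : Vec Bool (suc n)
    A = true ∷ as

  prototype⇒witness : IsPrototype (PathEdge n) (PathB n) (lookup A) (lookup f) → ∃[ g ] Witness n A f g
  prototype⇒witness (domain , _ , g , (_ , lipschitz , monotone) , agrees) = g , record
    { recorded   = λ { v (inj₁ v∈A) → agrees v (inj₁ v∈A) ; v (inj₂ last) → agrees v (inj₂ (inj₂ last)) }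
    ; unrecorded = unrecorded
    ; near       = λ u v e → abs≤1⇒near (g u) (g v) (lipschitz u v e)
    ; monotone   = monotone
    }
    where
    unrecorded : ∀ v → ¬ T (lookup A v) → toℕ v ≢ n → lookup f v ≡ nothing
    unrecorded v v∉A notLast with lookup f v in fv
    ... | nothing = refl
    ... | just z with proj₂ (domain v) z fv
    ... | inj₁ v∈A = ⊥-elim (v∉A v∈A)
    ... | inj₂ (inj₁ first) rewrite index0 first = ⊥-elim (v∉A tt)
    ... | inj₂ (inj₂ last) = ⊥-elim (notLast last)

  witness⇒prototype : ∀ {g} → Witness n A f g → IsPrototype (PathEdge n) (PathB n) (lookup A) (lookup f)
  witness⇒prototype {g} W =
    (λ v → (λ v∈A∪B → g v , agrees v v∈A∪B) , (λ z fv → inA∪B v fv)) ,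
    ((λ v → (λ v∈A → g v , extends v v∈A) , (λ z fv → restrict-defined (lookup A v) (lookup f v) fv)) , g , bucket) ,
    g , bucket , agrees
    where
    open Witness W
    agrees : ∀ v → T (lookup A v) ⊎ PathB n v → lookup f v ≡ just (g v)
    agrees v (inj₁ v∈A) = recorded v (inj₁ v∈A)
    agrees v (inj₂ (inj₁ first)) rewrite index0 first = recorded fzero (inj₁ tt)
    agrees v (inj₂ (inj₂ last)) = recorded v (inj₂ last)
    extends : ∀ v → T (lookup A v) → restrict (PathEdge n) (lookup A) (lookup f) v ≡ just (g v)
    extends v v∈A = trans (restrict-on (lookup A v) (lookup f v) v∈A) (recorded v (inj₁ v∈A))
    bucket : IsBucketExt (PathEdge n) (lookup A) (restrict (PathEdge n) (lookup A) (lookup f)) g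
    bucket = extends , (λ u v e → near⇒abs≤1 (g u) (g v) (near u v e)) , monotone
    inA∪B : ∀ v {z} → lookup f v ≡ just z → T (lookup A v) ⊎ PathB n v
    inA∪B v fv with lookup A v in Av | toℕ v ℕ.≟ n
    ... | true  | _ = inj₁ tt
    ... | false | yes last = inj₂ (inj₂ last)
    ... | false | no notLast with trans (sym fv) (unrecorded v (λ v∈A → subst T Av v∈A) notLast)
    ... | ()

-- The four ways a value can move along one edge of the path, each described
-- as membership in a range; these drive the enumeration below.

-- from a vertex of A with value a to a vertex of A
nearWindow⁺ : ∀ {a b} → Near a b → InRange (ℤ.pred a) 2 b
nearWindow⁺ {a} (p , q) = ≤suc⇒pred≤ p , subst (_ ℤ.≤_) (sym (pred+2 a)) q

nearWindow⁻ : ∀ {a b} → InRange (ℤ.pred a) 2 b → Near a b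
nearWindow⁻ {a} (p , q) = pred≤⇒≤suc p , subst (_ ℤ.≤_) (pred+2 a) q

-- from a vertex of A with value a to a vertex outside A (value may not rise)
lowerWindow⁺ : ∀ {a x} → Near a x → x ℤ.≤ a → InRange (ℤ.pred a) 1 x
lowerWindow⁺ {a} (p , _) x≤a = ≤suc⇒pred≤ p , subst (_ ℤ.≤_) (sym (pred+1 a)) x≤a

lowerWindow⁻ : ∀ {a x} → InRange (ℤ.pred a) 1 x → Near a x × x ℤ.≤ a
lowerWindow⁻ {a} (p , q) = (pred≤⇒≤suc p , ℤP.≤-trans x≤a (ℤP.i≤suc[i] a)) , x≤a
  where
  x≤a : _ ℤ.≤ a
  x≤a = subst (_ ℤ.≤_) (pred+1 a) q

-- from a vertex outside A with value in [lo, lo+k] to a vertex of A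
-- (value may not drop)
riseWindow⁺ : ∀ {lo k x b} → InRange lo k x → Near x b → x ℤ.≤ b → InRange lo (suc k) b
riseWindow⁺ {lo} {k} (p , q) (_ , b≤) x≤b =
  ℤP.≤-trans p x≤b , subst (_ ℤ.≤_) (sym (lo+suc lo k)) (ℤP.≤-trans b≤ (ℤP.suc-mono q))

riseWindow⁻ : ∀ {lo k b} → InRange lo (suc k) b → ∃[ x ] (InRange lo k x × Near x b × x ℤ.≤ b)
riseWindow⁻ {lo} {k} {b} (p , q) with b ℤP.≤? lo + + k
... | yes b≤top = b , (p , b≤top) , near-refl b , ℤP.≤-refl
... | no b≰top =
  lo + + k , (ℤP.i≤i+j lo (+ k) , ℤP.≤-refl) ,
  (ℤP.≤-trans top≤b (ℤP.i≤suc[i] b) , subst (b ℤ.≤_) (lo+suc lo k) q) , top≤b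
  where
  top≤b : lo + + k ℤ.≤ b
  top≤b = ℤP.<⇒≤ (ℤP.≰⇒> b≰top)

-- from a vertex outside A with value in [lo, lo+k] to a vertex outside A
driftWindow⁺ : ∀ {lo k x y} → InRange lo k x → Near x y → InRange (ℤ.pred lo) (suc (suc k)) y
driftWindow⁺ {lo} {k} (p , q) (x≤ , y≤) =
  ≤suc⇒pred≤ (ℤP.≤-trans p x≤) , subst (_ ℤ.≤_) (sym (pred+2+k lo k)) (ℤP.≤-trans y≤ (ℤP.suc-mono q))

driftWindow⁻ : ∀ {lo k y} → InRange (ℤ.pred lo) (suc (suc k)) y → ∃[ x ] (InRange lo k x × Near x y)
driftWindow⁻ {lo} {k} {y} (p , q) with y ℤP.<? lo | y ℤP.≤? lo + + k
... | yes y<lo | _ =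
  lo , (ℤP.≤-refl , ℤP.i≤i+j lo (+ k)) , pred≤⇒≤suc p , ℤP.≤-trans (ℤP.<⇒≤ y<lo) (ℤP.i≤suc[i] lo)
... | no y≮lo | yes y≤top = y , (ℤP.≮⇒≥ y≮lo , y≤top) , near-refl y
... | no _ | no y≰top =
  lo + + k , (ℤP.i≤i+j lo (+ k) , ℤP.≤-refl) ,
  ℤP.≤-trans (ℤP.<⇒≤ (ℤP.≰⇒> y≰top)) (ℤP.i≤suc[i] y) , subst (y ℤ.≤_) (pred+2+k lo k) q

-- Reading the path from v₀, a chain is determined by the
-- successive membership bits and recorded values; the value of a vertex
-- outside A is not recorded, so such a vertex is tracked by the range of
-- extension values it may take, which grows by one at each step (driftWindow).
-- The flag e says whether the last vertex may lie in A.

LastCondition : Bool → ∀ {m} → Vec Bool (suc m) → Set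
LastCondition e {m} A = e ≡ false → lookup A (fromℕ m) ≡ false

Tail : ℕ → Set
Tail m = Vec Bool m × Vec (Maybe ℤ) m

enterA : ∀ {m} → ℤ → Tail m → Tail (suc m)
enterA b (as , fs) = true ∷ as , just b ∷ fs

enterOut : ∀ {m} → Maybe ℤ × Tail m → Tail (suc m)
enterOut (y , as , fs) = false ∷ as , y ∷ fs

lastInA : Bool → List (Tail 0)
lastInA true  = ([] , []) ∷ []
lastInA false = []

-- a current vertex outside A records nothing, unless it is the last vertex
silent : ∀ {m} → Tail m → Maybe ℤ × Tail m
silent t = nothing , t

mutual
  -- the tails of chains whose current vertex is in A with value a
  fromA : Bool → ℤ → (m : ℕ) → List (Tail m)
  fromA e a zero = lastInA e
  fromA e a (suc m) = rangeConcat (intoA e m) (ℤ.pred a) 2 ++ map enterOut (fromOut e (ℤ.pred a) 1 m)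

  intoA : Bool → (m : ℕ) → ℤ → List (Tail (suc m))
  intoA e m b = map (enterA b) (fromA e b m)

  -- the recorded value and tail of chains whose current vertex is outside A
  -- with value in [lo, lo+k]
  fromOut : Bool → ℤ → ℕ → (m : ℕ) → List (Maybe ℤ × Tail m)
  fromOut e lo k zero = rangeConcat (λ z → (just z , [] , []) ∷ []) lo k
  fromOut e lo k (suc m) =
    map silent (rangeConcat (intoA e m) lo (suc k)) ++
    map (silent ∘ enterOut) (fromOut e (ℤ.pred lo) (suc (suc k)) m)

ValidFromA : Bool → ℤ → ∀ {m} → Tail m → Set
ValidFromA e a (as , fs) = ∃[ xs ] (Chain true a (just a) as fs xs × LastCondition e (true ∷ as))

ValidFromOut : Bool → ℤ → ℕ → ∀ {m} → Maybe ℤ × Tail m → Set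
ValidFromOut e lo k (y , as , fs) =
  ∃[ x ] (InRange lo k x × ∃[ xs ] (Chain false x y as fs xs × LastCondition e (false ∷ as)))

chain-head : ∀ {m x y} (as : Vec Bool m) {fs xs} → Chain true x y as fs xs → y ≡ just x
chain-head [] {[]} {[]} y≡x = y≡x
chain-head (_ ∷ _) {_ ∷ _} {_ ∷ _} (y≡x , _) = y≡x

∈-intoA⁻ : ∀ e m lo k {t} → t ∈ rangeConcat (intoA e m) lo k →
  ∃[ b ] (InRange lo k b × ∃[ t' ] (t ≡ enterA b t' × t' ∈ fromA e b m))
∈-intoA⁻ e m lo k t∈ with ∈-rangeConcat⁻ (intoA e m) lo k t∈
... | b , b∈ , t∈b with ∈-map⁻ (enterA b) t∈b
... | t' , t'∈ , t≡ = b , b∈ , t' , t≡ , t'∈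

∈-intoA⁺ : ∀ e m lo k {b t} → InRange lo k b → t ∈ fromA e b m → enterA b t ∈ rangeConcat (intoA e m) lo k
∈-intoA⁺ e m lo k {b} b∈ t∈ = ∈-rangeConcat⁺ (intoA e m) lo k b b∈ (∈-map⁺ (enterA b) t∈)

mutual
  fromA-sound : ∀ e a m {t} → t ∈ fromA e a m → ValidFromA e a t
  fromA-sound true a zero {[] , []} (here refl) = [] , refl , λ ()
  fromA-sound false a zero ()
  fromA-sound e a (suc m) t∈ with ∈-++⁻ (rangeConcat (intoA e m) (ℤ.pred a) 2) t∈
  ... | inj₁ t∈A with ∈-intoA⁻ e m (ℤ.pred a) 2 t∈A
  ...   | b , b∈ , t' , refl , t'∈ with fromA-sound e b m t'∈
  ...     | xs , chain , last = b ∷ xs , (refl , nearWindow⁻ b∈ , chain) , last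
  fromA-sound e a (suc m) t∈ | inj₂ t∈Out with ∈-map⁻ enterOut t∈Out
  ... | t' , t'∈ , refl with fromOut-sound e (ℤ.pred a) 1 m t'∈
  ...   | x , x∈ , xs , chain , last = x ∷ xs , (refl , lowerWindow⁻ x∈ , chain) , last

  fromOut-sound : ∀ e lo k m {t} → t ∈ fromOut e lo k m → ValidFromOut e lo k t
  fromOut-sound e lo k zero t∈ with ∈-rangeConcat⁻ _ lo k t∈
  ... | z , z∈ , here refl = z , z∈ , [] , refl , λ _ → refl
  fromOut-sound e lo k (suc m) t∈ with ∈-++⁻ (map silent (rangeConcat (intoA e m) lo (suc k))) t∈
  ... | inj₁ t∈A with ∈-map⁻ silent t∈A
  ...   | t' , t'∈ , refl with ∈-intoA⁻ e m lo (suc k) t'∈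
  ...     | b , b∈ , t'' , refl , t''∈ with riseWindow⁻ b∈ | fromA-sound e b m t''∈
  ...       | x , x∈ , near , x≤b | xs , chain , last = x , x∈ , b ∷ xs , (refl , (near , x≤b) , chain) , last
  fromOut-sound e lo k (suc m) t∈ | inj₂ t∈Out with ∈-map⁻ (silent ∘ enterOut) t∈Out
  ... | t' , t'∈ , refl with fromOut-sound e (ℤ.pred lo) (suc (suc k)) m t'∈
  ...   | y , y∈ , xs , chain , last with driftWindow⁻ y∈
  ...     | x , x∈ , near = x , x∈ , y ∷ xs , (refl , near , chain) , last

mutual
  fromA-complete : ∀ e a m {t : Tail m} → ValidFromA e a t → t ∈ fromA e a m
  fromA-complete true  a zero {[] , []} _ = here refl
  fromA-complete false a zero {[] , []} ([] , _ , last) with last refl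
  ... | ()
  fromA-complete e a (suc m) {true ∷ as , y ∷ fs} (x ∷ xs , (_ , near , chain) , last)
    with chain-head as chain
  ... | refl = ∈-++⁺ˡ (∈-intoA⁺ e m (ℤ.pred a) 2 (nearWindow⁺ near) (fromA-complete e x m (xs , chain , last)))
  fromA-complete e a (suc m) {false ∷ as , y ∷ fs} (x ∷ xs , (_ , (near , x≤a) , chain) , last) =
    ∈-++⁺ʳ (rangeConcat (intoA e m) (ℤ.pred a) 2)
      (∈-map⁺ enterOut (fromOut-complete e (ℤ.pred a) 1 m (x , lowerWindow⁺ near x≤a , xs , chain , last)))

  fromOut-complete : ∀ e lo k m {t : Maybe ℤ × Tail m} → ValidFromOut e lo k t → t ∈ fromOut e lo k m
  fromOut-complete e lo k zero {_ , [] , []} (x , x∈ , [] , refl , _) =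
    ∈-rangeConcat⁺ _ lo k x x∈ (here refl)
  fromOut-complete e lo k (suc m) {_ , true ∷ as , y ∷ fs} (x , x∈ , b ∷ xs , (refl , (near , x≤b) , chain) , last)
    with chain-head as chain
  ... | refl = ∈-++⁺ˡ (∈-map⁺ silent
      (∈-intoA⁺ e m lo (suc k) (riseWindow⁺ x∈ near x≤b) (fromA-complete e b m (xs , chain , last))))
  fromOut-complete e lo k (suc m) {_ , false ∷ as , y ∷ fs} (x , x∈ , x' ∷ xs , (refl , near , chain) , last) =
    ∈-++⁺ʳ (map silent (rangeConcat (intoA e m) lo (suc k)))
      (∈-map⁺ (silent ∘ enterOut)
        (fromOut-complete e (ℤ.pred lo) (suc (suc k)) m (x' , driftWindow⁺ x∈ near , xs , chain , last)))

mutual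
  countA : Bool → ℕ → ℕ
  countA e zero = if e then 1 else 0
  countA e (suc m) = 3 ℕ.* countA e m ℕ.+ countOut e 1 m

  countOut : Bool → ℕ → ℕ → ℕ
  countOut e k zero = suc k
  countOut e k (suc m) = suc (suc k) ℕ.* countA e m ℕ.+ countOut e (suc (suc k)) m

mutual
  length-fromA : ∀ e a m → length (fromA e a m) ≡ countA e m
  length-fromA true  a zero = refl
  length-fromA false a zero = refl
  length-fromA e a (suc m) =
    trans (length-++ (rangeConcat (intoA e m) (ℤ.pred a) 2))
      (cong₂ ℕ._+_ (length-rangeConcat (intoA e m) (countA e m) (length-intoA e m) (ℤ.pred a) 2)
                   (trans (length-map enterOut (fromOut e (ℤ.pred a) 1 m)) (length-fromOut e (ℤ.pred a) 1 m)))

  length-intoA : ∀ e m b → length (intoA e m b) ≡ countA e m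
  length-intoA e m b = trans (length-map (enterA b) (fromA e b m)) (length-fromA e b m)

  length-fromOut : ∀ e lo k m → length (fromOut e lo k m) ≡ countOut e k m
  length-fromOut e lo k zero = trans (length-rangeConcat _ 1 (λ _ → refl) lo k) (ℕP.*-identityʳ (suc k))
  length-fromOut e lo k (suc m) =
    trans (length-++ (map silent (rangeConcat (intoA e m) lo (suc k))))
      (cong₂ ℕ._+_
        (trans (length-map silent (rangeConcat (intoA e m) lo (suc k)))
               (length-rangeConcat (intoA e m) (countA e m) (length-intoA e m) lo (suc k)))
        (trans (length-map _ (fromOut e (ℤ.pred lo) (suc (suc k)) m))
               (length-fromOut e (ℤ.pred lo) (suc (suc k)) m)))

enterA-injective : ∀ {m} b {t t' : Tail m} → enterA b t ≡ enterA b t' → t ≡ t'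
enterA-injective b {_ , _} {_ , _} refl = refl

enterOut-injective : ∀ {m} {t t' : Maybe ℤ × Tail m} → enterOut t ≡ enterOut t' → t ≡ t'
enterOut-injective {t = _ , _ , _} {_ , _ , _} refl = refl

-- the value recorded at the first vertex of a tail (0 if none)
firstValue : ∀ {m} → Tail (suc m) → ℤ
firstValue (_ , just b ∷ _) = b
firstValue (_ , nothing ∷ _) = 0ℤ

intoA-labelled : ∀ e m b {t} → t ∈ intoA e m b → firstValue t ≡ b
intoA-labelled e m b t∈ with ∈-map⁻ (enterA b) t∈
... | _ , _ , refl = refl

intoA≢enterOut : ∀ e m lo k {t} t' → t ∈ rangeConcat (intoA e m) lo k → t ≢ enterOut t'
intoA≢enterOut e m lo k (_ , _ , _) t∈ t≡ with ∈-intoA⁻ e m lo k t∈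
... | _ , _ , _ , refl , _ with t≡
... | ()

mutual
  unique-fromA : ∀ e a m → Unique (fromA e a m)
  unique-fromA true  a zero = singleton-unique _
  unique-fromA false a zero = AllPairs.[]
  unique-fromA e a (suc m) =
    UniqueP.++⁺ (unique-rangeConcat-intoA e m (ℤ.pred a) 2)
      (UniqueP.map⁺ enterOut-injective (unique-fromOut e (ℤ.pred a) 1 m))
      λ (t∈A , t∈Out) → disjoint t∈A (∈-map⁻ enterOut t∈Out)
    where
    disjoint : ∀ {t} → t ∈ rangeConcat (intoA e m) (ℤ.pred a) 2 →
      ∃[ t' ] (t' ∈ fromOut e (ℤ.pred a) 1 m × t ≡ enterOut t') → ⊥
    disjoint t∈A (t' , _ , t≡) = intoA≢enterOut e m (ℤ.pred a) 2 t' t∈A t≡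

  unique-rangeConcat-intoA : ∀ e m lo k → Unique (rangeConcat (intoA e m) lo k)
  unique-rangeConcat-intoA e m = unique-rangeConcat (intoA e m) firstValue
    (λ b → UniqueP.map⁺ (enterA-injective b) (unique-fromA e b m)) (intoA-labelled e m)

  unique-fromOut : ∀ e lo k m → Unique (fromOut e lo k m)
  unique-fromOut e lo k zero = unique-rangeConcat _ (λ { (y , _) → fromMaybe 0ℤ y })
    (λ _ → singleton-unique _) (λ { b (here refl) → refl }) lo k
  unique-fromOut e lo k (suc m) =
    UniqueP.++⁺ (UniqueP.map⁺ ,-injectiveʳ (unique-rangeConcat-intoA e m lo (suc k)))
      (UniqueP.map⁺ (enterOut-injective ∘ ,-injectiveʳ) (unique-fromOut e (ℤ.pred lo) (suc (suc k)) m))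
      λ (t∈A , t∈Out) → disjoint (∈-map⁻ silent t∈A) (∈-map⁻ (silent ∘ enterOut) t∈Out)
    where
    disjoint : ∀ {t} → ∃[ t' ] (t' ∈ rangeConcat (intoA e m) lo (suc k) × t ≡ (nothing , t')) →
      ∃[ t'' ] (t'' ∈ fromOut e (ℤ.pred lo) (suc (suc k)) m × t ≡ (nothing , enterOut t'')) → ⊥
    disjoint (t' , t'∈ , refl) (t'' , _ , t≡) = intoA≢enterOut e m lo (suc k) t'' t'∈ (,-injectiveʳ t≡)

HasCount-cong : {X : Set} {P Q : X → Set} {k : ℕ} →
  (∀ x → P x → Q x) → (∀ x → Q x → P x) → HasCount P k → HasCount Q k
HasCount-cong P⇒Q Q⇒P (L , unique , len , members) =
  L , unique , len , λ x → (proj₁ (members x) ∘ Q⇒P x) , (P⇒Q x ∘ proj₂ (members x))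

CountedWith : Bool → (n : ℕ) → ℤ → ProtoData n → Set
CountedWith e n j (A , f) = CountedProto n j (A , f) × LastCondition e A

counted-sound : ∀ e n j {t} → t ∈ fromA e j n → CountedWith e n j (enterA j t)
counted-sound e n j t∈ with fromA-sound e j n t∈
... | xs , chain , last = (witness⇒prototype (chain⇒witness chain) , refl , refl) , last

counted-complete : ∀ e n j P → CountedWith e n j P → P ∈ map (enterA j) (fromA e j n)
counted-complete e n j (true ∷ as , just j ∷ fs) ((proto , refl , refl) , last) with prototype⇒witness proto
... | g , W = ∈-map⁺ (enterA j)
  (fromA-complete e j n (xs , subst (λ x → Chain true x (just j) as fs xs) g₀≡j (witness⇒chain W) , last))
  where
  xs : Vec ℤ n
  xs = tabulate (g ∘ fsuc)
  g₀≡j : g fzero ≡ j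
  g₀≡j = sym (just-injective (Witness.recorded W fzero (inj₁ tt)))

count-with : ∀ e n j → HasCount (CountedWith e n j) (countA e n)
count-with e n j =
  map (enterA j) (fromA e j n) ,
  UniqueP.map⁺ (enterA-injective j) (unique-fromA e j n) ,
  trans (length-map (enterA j) (fromA e j n)) (length-fromA e j n) ,
  λ P → counted-complete e n j P , sound P
  where
  sound : ∀ P → P ∈ map (enterA j) (fromA e j n) → CountedWith e n j P
  sound P P∈ with ∈-map⁻ (enterA j) P∈
  ... | t , t∈ , refl = counted-sound e n j t∈

count-prototypes : ∀ n j → HasCount (CountedProto n j) (countA true n)
count-prototypes n j = HasCount-cong (λ _ → proj₁) (λ _ counted → counted , λ ()) (count-with true n j)

count-notLast : ∀ n j → HasCount (CountedProtoNotLast n j) (countA false n)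
count-notLast n j = HasCount-cong (λ { (A , f) (counted , last) → counted , last refl })
  (λ { (A , f) (counted , notLast) → counted , λ _ → notLast }) (count-with false n j)

-- The counts as a linear recurrence.  For (a, α, β) = profile e m we have
-- countA e m = a and countOut e k m = (k+1)·α + β.

record Profile : Set where
  constructor ⟨_,_,_⟩
  field
    a α β : ℕ
open Profile

next : Profile → Profile
next ⟨ a , α , β ⟩ = ⟨ 3 ℕ.* a ℕ.+ 2 ℕ.* α ℕ.+ β , a ℕ.+ α , a ℕ.+ 2 ℕ.* α ℕ.+ β ⟩

profile : Bool → ℕ → Profile
profile e zero = ⟨ (if e then 1 else 0) , 1 , 0 ⟩
profile e (suc m) = next (profile e m)

mutual
  countA≡ : ∀ e m → countA e m ≡ a (profile e m)
  countA≡ e zero = refl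
  countA≡ e (suc m) rewrite countOut≡ e 1 m | countA≡ e m = regroup (a p) (α p) (β p)
    where
    p : Profile
    p = profile e m
    regroup : ∀ a α β → 3 ℕ.* a ℕ.+ (2 ℕ.* α ℕ.+ β) ≡ 3 ℕ.* a ℕ.+ 2 ℕ.* α ℕ.+ β
    regroup = ℕ-solve-∀

  countOut≡ : ∀ e k m → countOut e k m ≡ suc k ℕ.* α (profile e m) ℕ.+ β (profile e m)
  countOut≡ e k zero = sym (trans (ℕP.+-identityʳ _) (ℕP.*-identityʳ (suc k)))
  countOut≡ e k (suc m) rewrite countOut≡ e (suc (suc k)) m | countA≡ e m = regroup k (a p) (α p) (β p)
    where
    p : Profile
    p = profile e m
    regroup : ∀ k a α β → (2 ℕ.+ k) ℕ.* a ℕ.+ ((3 ℕ.+ k) ℕ.* α ℕ.+ β) ≡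
                           (1 ℕ.+ k) ℕ.* (a ℕ.+ α) ℕ.+ (a ℕ.+ 2 ℕ.* α ℕ.+ β)
    regroup = ℕ-solve-∀

≤-common : ∀ {x y} c p q → x ≡ c ℕ.+ p → y ≡ c ℕ.+ q → p ℕ.≤ q → x ℕ.≤ y
≤-common c p q refl refl p≤q = ℕP.+-monoʳ-≤ c p≤q

-- Growth: once the invariant below holds, each step multiplies a by at most 17/4.
GrowthInvariant : Profile → Set
GrowthInvariant ⟨ a , α , β ⟩ = 8 ℕ.* α ℕ.+ 4 ℕ.* β ℕ.≤ 5 ℕ.* a × 6 ℕ.* α ℕ.≤ 3 ℕ.* a ℕ.+ β

growthInvariant-next : ∀ p → GrowthInvariant p → GrowthInvariant (next p)
growthInvariant-next ⟨ a , α , β ⟩ (_ , second) =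
  ≤-common (12 ℕ.* a ℕ.+ 10 ℕ.* α ℕ.+ 4 ℕ.* β) (6 ℕ.* α) (3 ℕ.* a ℕ.+ β)
    (e₁ a α β) (e₂ a α β) second ,
  ≤-common (6 ℕ.* a ℕ.+ 6 ℕ.* α) 0 (4 ℕ.* a ℕ.+ 2 ℕ.* α ℕ.+ 4 ℕ.* β) (e₃ a α β) (e₄ a α β) z≤n
  where
  e₁ : ∀ a α β → 8 ℕ.* (a ℕ.+ α) ℕ.+ 4 ℕ.* (a ℕ.+ 2 ℕ.* α ℕ.+ β) ≡
                 12 ℕ.* a ℕ.+ 10 ℕ.* α ℕ.+ 4 ℕ.* β ℕ.+ 6 ℕ.* α
  e₁ = ℕ-solve-∀
  e₂ : ∀ a α β → 5 ℕ.* (3 ℕ.* a ℕ.+ 2 ℕ.* α ℕ.+ β) ≡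
                 12 ℕ.* a ℕ.+ 10 ℕ.* α ℕ.+ 4 ℕ.* β ℕ.+ (3 ℕ.* a ℕ.+ β)
  e₂ = ℕ-solve-∀
  e₃ : ∀ a α β → 6 ℕ.* (a ℕ.+ α) ≡ 6 ℕ.* a ℕ.+ 6 ℕ.* α ℕ.+ 0
  e₃ = ℕ-solve-∀
  e₄ : ∀ a α β → 3 ℕ.* (3 ℕ.* a ℕ.+ 2 ℕ.* α ℕ.+ β) ℕ.+ (a ℕ.+ 2 ℕ.* α ℕ.+ β) ≡
                 6 ℕ.* a ℕ.+ 6 ℕ.* α ℕ.+ (4 ℕ.* a ℕ.+ 2 ℕ.* α ℕ.+ 4 ℕ.* β)
  e₄ = ℕ-solve-∀

growthInvariant-from2 : ∀ m → GrowthInvariant (profile true (2 ℕ.+ m))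
growthInvariant-from2 zero = toWitness {a? = _ ℕ.≤? _} tt , toWitness {a? = _ ℕ.≤? _} tt
growthInvariant-from2 (suc m) = growthInvariant-next (profile true (2 ℕ.+ m)) (growthInvariant-from2 m)

growth-next : ∀ p → GrowthInvariant p → 4 ℕ.* a (next p) ℕ.≤ 17 ℕ.* a p
growth-next ⟨ a , α , β ⟩ (first , _) =
  ≤-common (12 ℕ.* a) (8 ℕ.* α ℕ.+ 4 ℕ.* β) (5 ℕ.* a) (e₁ a α β) (e₂ a) first
  where
  e₁ : ∀ a α β → 4 ℕ.* (3 ℕ.* a ℕ.+ 2 ℕ.* α ℕ.+ β) ≡ 12 ℕ.* a ℕ.+ (8 ℕ.* α ℕ.+ 4 ℕ.* β)
  e₁ = ℕ-solve-∀
  e₂ : ∀ a → 17 ℕ.* a ≡ 12 ℕ.* a ℕ.+ 5 ℕ.* a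
  e₂ = ℕ-solve-∀

countA-growth : ∀ m → 4 ℕ.* countA true (3 ℕ.+ m) ℕ.≤ 17 ℕ.* countA true (2 ℕ.+ m)
countA-growth m rewrite countA≡ true (3 ℕ.+ m) | countA≡ true (2 ℕ.+ m) =
  growth-next (profile true (2 ℕ.+ m)) (growthInvariant-from2 m)

-- Comparison: componentwise 2·p ≤ 5·q is preserved by next, whose
-- coefficients are nonnegative; it holds from m = 1 between e = true and e = false.
Dominates : Profile → Profile → Set
Dominates p q = 2 ℕ.* a p ℕ.≤ 5 ℕ.* a q × 2 ℕ.* α p ℕ.≤ 5 ℕ.* α q × 2 ℕ.* β p ℕ.≤ 5 ℕ.* β q

dominates-next : ∀ p q → Dominates p q → Dominates (next p) (next q)
dominates-next ⟨ a , α , β ⟩ ⟨ a' , α' , β' ⟩ (≤a , ≤α , ≤β) =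
  subst₂ ℕ._≤_ (e₁ 2 a α β) (e₁ 5 a' α' β')
    (ℕP.+-mono-≤ (ℕP.+-mono-≤ (ℕP.*-monoʳ-≤ 3 ≤a) (ℕP.*-monoʳ-≤ 2 ≤α)) ≤β) ,
  subst₂ ℕ._≤_ (e₂ 2 a α) (e₂ 5 a' α') (ℕP.+-mono-≤ ≤a ≤α) ,
  subst₂ ℕ._≤_ (e₃ 2 a α β) (e₃ 5 a' α' β')
    (ℕP.+-mono-≤ (ℕP.+-mono-≤ ≤a (ℕP.*-monoʳ-≤ 2 ≤α)) ≤β)
  where
  e₁ : ∀ c a α β → 3 ℕ.* (c ℕ.* a) ℕ.+ 2 ℕ.* (c ℕ.* α) ℕ.+ c ℕ.* β ≡
                   c ℕ.* (3 ℕ.* a ℕ.+ 2 ℕ.* α ℕ.+ β)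
  e₁ = ℕ-solve-∀
  e₂ : ∀ c a α → c ℕ.* a ℕ.+ c ℕ.* α ≡ c ℕ.* (a ℕ.+ α)
  e₂ = ℕ-solve-∀
  e₃ : ∀ c a α β → c ℕ.* a ℕ.+ 2 ℕ.* (c ℕ.* α) ℕ.+ c ℕ.* β ≡ c ℕ.* (a ℕ.+ 2 ℕ.* α ℕ.+ β)
  e₃ = ℕ-solve-∀

dominates-from1 : ∀ m → Dominates (profile true (suc m)) (profile false (suc m))
dominates-from1 zero = toWitness {a? = _ ℕ.≤? _} tt , toWitness {a? = _ ℕ.≤? _} tt , toWitness {a? = _ ℕ.≤? _} tt
dominates-from1 (suc m) = dominates-next (profile true (suc m)) (profile false (suc m)) (dominates-from1 m)

countA-notLast : ∀ m → 2 ℕ.* countA true (suc m) ℕ.≤ 5 ℕ.* countA false (suc m)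
countA-notLast m rewrite countA≡ true (suc m) | countA≡ false (suc m) = proj₁ (dominates-from1 m)

coprime/1 : ∀ n → Coprime.Coprime n 1
coprime/1 n = Coprime.sym (Coprime.1-coprimeTo n)

nat/1 : ∀ n → + n / 1 ≡ mkℚ (+ n) 0 (coprime/1 n)
nat/1 n = ℚP.normalize-coprime (coprime/1 n)

pos-*-assocʳ : ∀ a b c → + (a ℕ.* (b ℕ.* c)) ≡ + a ℤ.* (+ b ℤ.* + c)
pos-*-assocʳ a b c = trans (ℤP.pos-* a (b ℕ.* c)) (cong (+ a ℤ.*_) (ℤP.pos-* b c))

pos-*-assocˡ : ∀ a b c → + (a ℕ.* b ℕ.* c) ≡ (+ a ℤ.* + b) ℤ.* + c
pos-*-assocˡ a b c = trans (ℤP.pos-* (a ℕ.* b) c) (cong (ℤ._* + c) (ℤP.pos-* a b))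

*-comm-*1 : ∀ d x → d ℕ.* x ≡ x ℕ.* (d ℕ.* 1)
*-comm-*1 d x = trans (ℕP.*-comm d x) (cong (x ℕ.*_) (sym (ℕP.*-identityʳ d)))

≤-scaledˡ : ∀ (q : ℚ) {p d} → ↥ q ≡ + p → ↧ q ≡ + d → ∀ x y →
  d ℕ.* x ℕ.≤ p ℕ.* y → + x / 1 ≤ q * (+ y / 1)
≤-scaledˡ q@record{} {p} {d} refl refl x y h rewrite nat/1 x | nat/1 y =
  ℚP.toℚᵘ-cancel-≤
    (ℚᵘP.≤-respʳ-≃ (ℚᵘP.≃-sym (ℚP.toℚᵘ-homo-* q (mkℚ (+ y) 0 (coprime/1 y)))) (ℚᵘ.*≤* cross))
  where
  cross : + x ℤ.* (+ d ℤ.* + 1) ℤ.≤ (+ p ℤ.* + y) ℤ.* + 1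
  cross = subst₂ ℤ._≤_ (pos-*-assocʳ x d 1) (pos-*-assocˡ p y 1)
    (+≤+ (subst₂ ℕ._≤_ (*-comm-*1 d x) (sym (ℕP.*-identityʳ (p ℕ.* y))) h))

≤-scaledʳ : ∀ (q : ℚ) {p d} → ↥ q ≡ + p → ↧ q ≡ + d → ∀ x y →
  p ℕ.* x ℕ.≤ d ℕ.* y → q * (+ x / 1) ≤ + y / 1
≤-scaledʳ q@record{} {p} {d} refl refl x y h rewrite nat/1 x | nat/1 y =
  ℚP.toℚᵘ-cancel-≤
    (ℚᵘP.≤-respˡ-≃ (ℚᵘP.≃-sym (ℚP.toℚᵘ-homo-* q (mkℚ (+ x) 0 (coprime/1 x)))) (ℚᵘ.*≤* cross))
  where
  cross : (+ p ℤ.* + x) ℤ.* + 1 ℤ.≤ + y ℤ.* (+ d ℤ.* + 1)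
  cross = subst₂ ℤ._≤_ (pos-*-assocˡ p x 1) (pos-*-assocʳ y d 1)
    (+≤+ (subst₂ ℕ._≤_ (sym (ℕP.*-identityʳ (p ℕ.* x))) (*-comm-*1 d y) h))

^ℚ-nonNeg : ∀ {c} → 0ℚ ≤ c → ∀ k → 0ℚ ≤ c ^ℚ k
^ℚ-nonNeg 0≤c zero = ℚP.≤ᵇ⇒≤ tt
^ℚ-nonNeg {c} 0≤c (suc k) =
  ℚP.nonNegative⁻¹ _ {{ℚP.nonNeg*nonNeg⇒nonNeg c {{nonNegative 0≤c}} (c ^ℚ k) {{nonNegative (^ℚ-nonNeg 0≤c k)}}}}

geometric-bound : ∀ (K r c : ℚ) (s : ℕ → ℚ) → 0ℚ ≤ K → 0ℚ ≤ r → r ≤ c →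
  s 0 ≤ K * (c ^ℚ 0) → s 1 ≤ K * (c ^ℚ 1) → (∀ k → s (2 ℕ.+ k) ≤ r * s (1 ℕ.+ k)) →
  ∀ k → s k ≤ K * (c ^ℚ k)
geometric-bound K r c s _ _ _ s₀ _ _ zero = s₀
geometric-bound K r c s _ _ _ _ s₁ _ (suc zero) = s₁
geometric-bound K r c s 0≤K 0≤r r≤c s₀ s₁ ratio (suc (suc k)) = begin
  s (2 ℕ.+ k)             ≤⟨ ratio k ⟩
  r * s (1 ℕ.+ k)         ≤⟨ ℚP.*-monoˡ-≤-nonNeg r {{nonNegative 0≤r}}
                               (geometric-bound K r c s 0≤K 0≤r r≤c s₀ s₁ ratio (suc k)) ⟩
  r * (K * cᵏ⁺¹)          ≤⟨ ℚP.*-monoʳ-≤-nonNeg (K * cᵏ⁺¹) {{nonNegative 0≤Kcᵏ⁺¹}} r≤c ⟩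
  c * (K * cᵏ⁺¹)          ≡⟨ swap c K cᵏ⁺¹ ⟩
  K * (c * cᵏ⁺¹)          ∎
  where
  open ℚP.≤-Reasoning
  cᵏ⁺¹ : ℚ
  cᵏ⁺¹ = c ^ℚ suc k
  0≤Kcᵏ⁺¹ : 0ℚ ≤ K * cᵏ⁺¹
  0≤Kcᵏ⁺¹ = ℚP.nonNegative⁻¹ _ {{ℚP.nonNeg*nonNeg⇒nonNeg K {{nonNegative 0≤K}} cᵏ⁺¹
              {{nonNegative (^ℚ-nonNeg (ℚP.≤-trans 0≤r r≤c) (suc k))}}}}
  swap : ∀ x y z → x * (y * z) ≡ y * (x * z)
  swap x y z = trans (sym (ℚP.*-assoc x y z)) (trans (cong (_* z) (ℚP.*-comm x y)) (ℚP.*-assoc y x z))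

-- Lemma 17, with ε₀ = 1/2000.  The base c = 4.383 - ε is then at least
-- c₀ = 4.383 - 1/2000 ≥ 17/4, the eventual growth ratio of the counts, and
-- the first two counts 5 and 22 lie below 5.02 and 5.02·c₀; the proportion
-- 0.4 = 2/5 of prototypes with v_n ∉ A comes from countA-notLast.
lemma17 : ∃[ ε₀ ] (0ℚ < ε₀ × (∀ (ε : ℚ) → 0ℚ < ε → ε < ε₀ →
            ∀ (n : ℕ) → 1 ℕ.≤ n → ∀ (j : ℤ) →
              ∃[ S ] (HasCount (CountedProto n j) S
                × (+ S / 1 ≤ (+ 502 / 100) * (((+ 4383 / 1000) - ε) ^ℚ (n ∸ 1)))
                × ∃[ m ] (HasCount (CountedProtoNotLast n j) m
                    × (+ 4 / 10) * (+ S / 1) ≤ + m / 1))))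
lemma17 = ε₀ , toWitness {a? = 0ℚ ℚP.<? ε₀} tt , λ { ε _ ε<ε₀ (suc k) _ j →
  countA true (suc k) , count-prototypes (suc k) j , count-bound ε<ε₀ k ,
  countA false (suc k) , count-notLast (suc k) j , notLast-share k }
  where
  ε₀ K : ℚ
  ε₀ = + 1 / 2000
  K = + 502 / 100
  c : ℚ → ℚ
  c ε = (+ 4383 / 1000) - ε
  c₀≤c : ∀ {ε} → ε < ε₀ → c ε₀ ≤ c ε
  c₀≤c ε<ε₀ = ℚP.+-monoʳ-≤ (+ 4383 / 1000) (ℚP.neg-antimono-≤ (ℚP.<⇒≤ ε<ε₀))
  count-bound : ∀ {ε} → ε < ε₀ → ∀ k → + countA true (suc k) / 1 ≤ K * (c ε ^ℚ k)
  count-bound {ε} ε<ε₀ = geometric-bound K (+ 17 / 4) (c ε) (λ i → + countA true (suc i) / 1)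
    (ℚP.≤ᵇ⇒≤ tt) (ℚP.≤ᵇ⇒≤ tt) (ℚP.≤-trans (ℚP.≤ᵇ⇒≤ tt) (c₀≤c ε<ε₀))
    (ℚP.≤ᵇ⇒≤ tt) (ℚP.≤-trans (ℚP.≤ᵇ⇒≤ tt) (ℚP.*-monoˡ-≤-nonNeg K (ℚP.*-monoʳ-≤-nonNeg 1ℚ (c₀≤c ε<ε₀))))
    (λ i → ≤-scaledˡ (+ 17 / 4) refl refl (countA true (3 ℕ.+ i)) (countA true (2 ℕ.+ i)) (countA-growth i))
  notLast-share : ∀ k → (+ 4 / 10) * (+ countA true (suc k) / 1) ≤ + countA false (suc k) / 1
  notLast-share k = ≤-scaledʳ (+ 4 / 10) refl refl (countA true (suc k)) (countA false (suc k)) (countA-notLast k)
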